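{- Let $w$ be a factor of $f_{\infty,\infty}$ of size $(k,l)$, $k,l\ge1$, with first column $L$ and first row $T$. Let the column alphabet $(s_1,s_2)$ of $w$ be $(d,b)$ if the top-left letter of $w$ is in $\{d,b\}$ and $(c,a)$ otherwise, and the row alphabet $(s_1',s_2')$ be $(d,c)$ if the top-left letter is in $\{d,c\}$ and $(b,a)$ otherwise. Let $fo_L$ be the first occurrence of $L$ in $f_\infty^{s_1,s_2}$ and $fo_T$ the first occurrence of $T$ in $f_\infty^{s_1',s_2'}$. Let $m\ge2$ be least such that $L$ is a factor of $g_m^{s_1,s_2}$, and $n\ge2$ least such that $T$ is a factor of $g_n^{s_1',s_2'}$. Then the set of occurrences of $w$ in $f_{\infty,\infty}$ is $X\times Y$, where $X=\mathcal{Z}_{m-1}\boxplus fo_L$ and $Y=\mathcal{Z}_{n-1}\boxplus fo_T$.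
   Context: For letters $s_1,s_2$, $f_\infty^{s_1,s_2}=s_1s_2s_1s_1s_2s_1s_2s_1\cdots$ is the image of $x=x_1x_2\cdots=101101011\cdots$ (fixed point of $1\mapsto10,0\mapsto1$) under $1\mapsto s_1,0\mapsto s_2$. Define $f_0^{s_1,s_2}=s_1$, $f_1^{s_1,s_2}=s_1s_2$, $f_{p+1}^{s_1,s_2}=f_p^{s_1,s_2}f_{p-1}^{s_1,s_2}$, and for $p\ge2$ let $g_p^{s_1,s_2}$ be $f_p^{s_1,s_2}$ with its last two letters removed. Let $G(0)=1,G(1)=2,G(p+1)=G(p)+G(p-1)$; every nonnegative integer has a unique representation as a sum of pairwise non-consecutive $G(i)$'s (empty sum $=0$), and $\mathcal{Z}_p$ ($p\ge1$) is the set of nonnegative integers whose representation uses none of $G(0),\dots,G(p-1)$. For a set $S$ of integers and an integer $t$, $S\boxplus t=\{s+t:s\in S\}$. $f_{\infty,\infty}=[f(i,j)]_{i,j\ge1}$ over $\{a,b,c,d\}$ is the fixed point $\lim_n\mu^n(d)$ of the $2D$ morphism $d\mapsto\begin{smallmatrix}d&c\\ b&a\end{smallmatrix}$, $c\mapsto\begin{smallmatrix}d\\ b\end{smallmatrix}$, $b\mapsto\begin{smallmatrix}d&c\end{smallmatrix}$, $a\mapsto d$; equivalently $f(i,j)=d,c,b,a$ according as $(x_i,x_j)=(1,1),(1,0),(0,1),(0,0)$. For an infinite word $y$ and finite word $u$, an occurrence is $i\ge0$ with $y_{i+1}\cdots y_{i+|u|}=u$; the first occurrence is the least one. An occurrence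 of a $k\times l$ array $w$ in $f_{\infty,\infty}$ is a pair $(i,j)$, $i,j\ge0$, such that the block in rows $i+1,\dots,i+k$ and columns $j+1,\dots,j+l$ equals $w$. -}

module Defs where

open import Data.Nat using (ℕ; zero; suc; _+_; _∸_; _≤_; _<_)
open import Data.Bool using (Bool; true; false)
open import Data.List using (List; []; _∷_; _++_; length; concatMap; take; map; lookup; tabulate)
open import Data.Nat.ListAction using (sum)
open import Data.List.Relation.Unary.All using (All)
open import Data.Fin using (Fin; toℕ)
open import Data.Product using (Σ; ∃; _×_; _,_)
open import Relation.Binary.PropositionalEquality using (_≡_)

data Letter : Set where
  a b c d : Letter

σ : Bool → List Bool
σ true  = true ∷ false ∷ []
σ false = true ∷ []

σIter : ℕ → List Bool
σIter zero    = true ∷ []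
σIter (suc n) = concatMap σ (σIter n)

nth : {A : Set} → A → List A → ℕ → A
nth def []       _       = def
nth def (y ∷ ys) zero    = y
nth def (y ∷ ys) (suc i) = nth def ys i

-- x i  is the letter x_i (1-indexed, i ≥ 1); |σ^i(1)| ≥ i+1 so the
-- default is never used for i ≥ 1.
x : ℕ → Bool
x i = nth false (σIter i) (i ∸ 1)

sub : Letter → Letter → Bool → Letter
sub s₁ s₂ true  = s₁
sub s₁ s₂ false = s₂

-- f_∞^{s₁,s₂} as a 0-indexed infinite word: position i holds letter number i+1
fInf : Letter → Letter → ℕ → Letter
fInf s₁ s₂ i = sub s₁ s₂ (x (suc i))

fFin : Letter → Letter → ℕ → List Letter
fFin s₁ s₂ zero          = s₁ ∷ []
fFin s₁ s₂ (suc zero)    = s₁ ∷ s₂ ∷ []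
fFin s₁ s₂ (suc (suc p)) = fFin s₁ s₂ (suc p) ++ fFin s₁ s₂ p

gFin : Letter → Letter → ℕ → List Letter
gFin s₁ s₂ p = take (length (fFin s₁ s₂ p) ∸ 2) (fFin s₁ s₂ p)

IsFactor : {A : Set} → List A → List A → Set
IsFactor {A} u v = Σ (List A) λ p → Σ (List A) λ s → p ++ u ++ s ≡ v

Occ : {A : Set} → (ℕ → A) → List A → ℕ → Set
Occ y u i = (k : Fin (length u)) → y (i + toℕ k) ≡ lookup u k

IsLeast : (ℕ → Set) → ℕ → Set
IsLeast P n = P n × ((m : ℕ) → P m → n ≤ m)

G : ℕ → ℕ
G zero          = 1
G (suc zero)    = 2
G (suc (suc p)) = G (suc p) + G p

NonConsec : List ℕ → Set
NonConsec []           = Data.Unit.⊤ where import Data.Unit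
NonConsec (i ∷ [])     = Data.Unit.⊤ where import Data.Unit
NonConsec (i ∷ j ∷ is) = (2 + j ≤ i) × NonConsec (j ∷ is)

IsRep : ℕ → List ℕ → Set
IsRep n rep = NonConsec rep × (sum (map G rep) ≡ n)

Z : ℕ → ℕ → Set
Z p n = Σ (List ℕ) λ rep → IsRep n rep × All (λ i → p ≤ i) rep

InShift : (ℕ → Set) → ℕ → ℕ → Set
InShift S t i = ∃ λ s → S s × i ≡ s + t

-- The 2D Fibonacci word f_{∞,∞}, 1-indexed: f(i,j)

f2 : ℕ → ℕ → Letter
f2 i j with x i | x j
... | true  | true  = d
... | true  | false = c
... | false | true  = b
... | false | false = a

Occ2 : {k l : ℕ} → (Fin k → Fin l → Letter) → ℕ → ℕ → Set
Occ2 w i j = ∀ r s → f2 (suc (i + toℕ r)) (suc (j + toℕ s)) ≡ w r s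

IsFactor2 : {k l : ℕ} → (Fin k → Fin l → Letter) → Set
IsFactor2 w = ∃ λ i → ∃ λ j → Occ2 w i j

colAlph₁ colAlph₂ rowAlph₁ rowAlph₂ : Letter → Letter
colAlph₁ d = d
colAlph₁ b = d
colAlph₁ c = c
colAlph₁ a = c
colAlph₂ d = b
colAlph₂ b = b
colAlph₂ c = a
colAlph₂ a = a
rowAlph₁ d = d
rowAlph₁ c = d
rowAlph₁ b = b
rowAlph₁ a = b
rowAlph₂ d = c
rowAlph₂ c = c
rowAlph₂ b = a
rowAlph₂ a = a

firstCol : {k l : ℕ} → (Fin (suc k) → Fin (suc l) → Letter) → List Letter
firstCol w = tabulate (λ r → w r Fin.zero) where import Data.Fin as Fin

firstRow : {k l : ℕ} → (Fin (suc k) → Fin (suc l) → Letter) → List Letter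
firstRow w = tabulate (λ s → w Fin.zero s) where import Data.Fin as Fin

{-# OPTIONS --safe #-}

-- Let X be the Fibonacci word over {0,1}. The words f_{t+1} f_t and f_t f_{t+1} coincide except
-- that their last two letters are swapped, and X begins with f_{t+1} f_t f_{t+1}; so shifting X
-- by G t preserves the letter at every position y with y + 2 < G (t+1) and flips it at
-- y + 2 = G (t+1). Reading a member z of 𝒵_q from its smallest part upwards, this gives
-- X (z + i) = X i whenever i + 2 < G (q+1), while for i + 2 = G (q+1) the letter flips exactly
-- when the smallest part of z is G q. Hence, by induction on the length of a factor of X, its set
-- of occurrences stays 𝒵_q ⊞ fo while the first occurrence, extended by one letter, still lies
-- inside g_{q+1}; once it fills g_{q+1} exactly, the next letter refines the set to
-- 𝒵_{q+1} ⊞ fo or to 𝒵_{q+2} ⊞ (G q + fo). Finally, the letter of f_{∞,∞} at (i,j) encodes the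
-- pair (x_i, x_j), so an array occurs at (i,j) iff its first column occurs at i and its first
-- row at j in the corresponding one-dimensional words.

module Submission where

open import Defs
open import Data.Nat
  using (ℕ; zero; suc; _+_; _∸_; _≤_; _<_; _≤′_; ≤′-refl; ≤′-step; z≤n; s≤s; _<?_)
open import Data.Nat.Properties
open import Data.Bool using (Bool; true; false; not)
open import Data.Bool.Properties using (not-¬; ¬-not; not-involutive)
import Data.Bool as Bool
open import Data.List using (List; []; _∷_; _++_; _∷ʳ_; length; concatMap; take; map; tabulate)
open import Data.List.Properties
  using (++-assoc; length-++; concatMap-++; map-++; ∷-injective; ∷ʳ-injective; map-injective)
open import Data.List.Reverse using (Reverse; reverseView; []; _∶_∶ʳ_)
open import Data.List.Relation.Unary.All using (All; []; _∷_)
import Data.List.Relation.Unary.All as All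
open import Data.List.Relation.Unary.All.Properties using (∷ʳ⁺; ∷ʳ⁻)
open import Data.Nat.ListAction using (sum)
open import Data.Nat.ListAction.Properties using (sum-++)
open import Data.Empty using (⊥-elim)
open import Data.Nat.Tactic.RingSolver using (solve-∀)
open import Data.Fin using (Fin; zero; suc; toℕ)
open import Data.Product using (∃; ∃₂; _×_; _,_; proj₁; proj₂)
open import Data.Sum using (inj₁; inj₂)
open import Function using (_∘_)
open import Function.Bundles using (_⇔_; mk⇔; Equivalence)
open import Relation.Nullary using (yes; no)
open import Relation.Binary.PropositionalEquality
open import Data.Product.Function.NonDependent.Propositional using (_×-⇔_)
open import Function.Properties.Equivalence using () renaming (trans to ⇔-trans; sym to ⇔-sym)

open Equivalence using (to; from)

≡⇔≡ : ∀ {A : Set} {x x′ y y′ : A} → x ≡ x′ → y ≡ y′ → (x ≡ y) ⇔ (x′ ≡ y′)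
≡⇔≡ x≡ y≡ = mk⇔ (λ e → trans (sym x≡) (trans e y≡)) (λ e → trans x≡ (trans e (sym y≡)))

Π-cong⇔ : ∀ {I : Set} {P Q : I → Set} → (∀ r → P r ⇔ Q r) → (∀ r → P r) ⇔ (∀ r → Q r)
Π-cong⇔ P⇔Q = mk⇔ (λ p r → to (P⇔Q r) (p r)) (λ q r → from (P⇔Q r) (q r))

-- The numbers G

G-positive : ∀ p → 0 < G p
G-positive zero = s≤s z≤n
G-positive (suc zero) = s≤s z≤n
G-positive (suc (suc p)) = ≤-trans (G-positive (suc p)) (m≤m+n _ _)

G-<-suc : ∀ p → G p < G (suc p)
G-<-suc zero = s≤s (s≤s z≤n)
G-<-suc (suc p) = m<m+n (G (suc p)) (G-positive p)

G-mono-≤ : ∀ {p p′} → p ≤ p′ → G p ≤ G p′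
G-mono-≤ p≤p′ = go (≤⇒≤′ p≤p′)
  where
  go : ∀ {p p′} → p ≤′ p′ → G p ≤ G p′
  go ≤′-refl = ≤-refl
  go (≤′-step {n = p′} h) = ≤-trans (go h) (<⇒≤ (G-<-suc p′))

G-cancel-< : ∀ {p p′} → G p < G p′ → p < p′
G-cancel-< h = ≰⇒> (λ p′≤p → <⇒≱ h (G-mono-≤ p′≤p))

G-suc≤double : ∀ p → G (suc p) ≤ G p + G p
G-suc≤double zero = ≤-refl
G-suc≤double (suc p) = +-monoʳ-≤ (G (suc p)) (<⇒≤ (G-<-suc p))

n<G : ∀ n → n < G n
n<G zero = s≤s z≤n
n<G (suc zero) = s≤s (s≤s z≤n)
n<G (suc (suc n)) =
  subst (_≤ G (suc (suc n))) (+-comm (suc (suc n)) 1) (+-mono-≤ (n<G (suc n)) (G-positive n))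

-- Lists and windows of infinite words

nth-++ˡ : ∀ {A : Set} (δ : A) xs ys {r} → r < length xs → nth δ (xs ++ ys) r ≡ nth δ xs r
nth-++ˡ δ (y ∷ xs) ys {zero} _ = refl
nth-++ˡ δ (y ∷ xs) ys {suc r} (s≤s r<) = nth-++ˡ δ xs ys r<

nth-++ʳ : ∀ {A : Set} (δ : A) xs ys r → nth δ (xs ++ ys) (length xs + r) ≡ nth δ ys r
nth-++ʳ δ [] ys r = refl
nth-++ʳ δ (y ∷ xs) ys r = nth-++ʳ δ xs ys r

++-injective : ∀ {A : Set} (xs xs′ : List A) {ys ys′} →
  length xs ≡ length xs′ → xs ++ ys ≡ xs′ ++ ys′ → xs ≡ xs′ × ys ≡ ys′
++-injective [] [] _ e = refl , e
++-injective (y ∷ xs) (y′ ∷ xs′) |xs|≡ e with refl , e′ ← ∷-injective e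
  with refl , e″ ← ++-injective xs xs′ (suc-injective |xs|≡) e′ = refl , e″

window : {A : Set} → (ℕ → A) → ℕ → ℕ → List A
window y i zero = []
window y i (suc l) = y i ∷ window y (suc i) l

module _ {A : Set} (y : ℕ → A) where

  length-window : ∀ i l → length (window y i l) ≡ l
  length-window i zero = refl
  length-window i (suc l) = cong suc (length-window (suc i) l)

  window-++ : ∀ i l l′ → window y i (l + l′) ≡ window y i l ++ window y (i + l) l′
  window-++ i zero l′ = cong (λ j → window y j l′) (sym (+-identityʳ i))
  window-++ i (suc l) l′ =
    cong (y i ∷_) (trans (window-++ (suc i) l l′)
                         (cong (λ j → window y (suc i) l ++ window y j l′) (sym (+-suc i l))))

  window-∷ʳ : ∀ i l → window y i (suc l) ≡ window y i l ∷ʳ y (i + l)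
  window-∷ʳ i l = trans (cong (window y i) (+-comm 1 l)) (window-++ i l 1)

  map-window : ∀ {B : Set} (f : A → B) i l → map f (window y i l) ≡ window (f ∘ y) i l
  map-window f i zero = refl
  map-window f i (suc l) = cong (f (y i) ∷_) (map-window f (suc i) l)

  take-window : ∀ i {k l} → k ≤ l → take k (window y i l) ≡ window y i k
  take-window i z≤n = refl
  take-window i (s≤s k≤l) = cong (y i ∷_) (take-window (suc i) k≤l)

  nth-agree⇒≡window : ∀ (δ : A) v i → (∀ r → r < length v → nth δ v r ≡ y (i + r)) →
    v ≡ window y i (length v)
  nth-agree⇒≡window δ [] i _ = refl
  nth-agree⇒≡window δ (α ∷ v) i h = cong₂ _∷_ (trans (h 0 (s≤s z≤n)) (cong y (+-identityʳ i)))
    (nth-agree⇒≡window δ v (suc i) (λ r r< → trans (h (suc r) (s≤s r<)) (cong y (+-suc i r))))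

  Occ-∷⇔ : ∀ α u n → Occ y (α ∷ u) n ⇔ (y n ≡ α × Occ y u (suc n))
  Occ-∷⇔ α u n = mk⇔
    (λ o → trans (cong y (sym (+-identityʳ n))) (o zero)
         , λ k → trans (cong y (sym (+-suc n (toℕ k)))) (o (suc k)))
    λ { (h , o) zero → trans (cong y (+-identityʳ n)) h
      ; (h , o) (suc k) → trans (cong y (+-suc n (toℕ k))) (o k) }

  Occ⇔window : ∀ u n → Occ y u n ⇔ window y n (length u) ≡ u
  Occ⇔window [] n = mk⇔ (λ _ → refl) (λ _ ())
  Occ⇔window (α ∷ u) n = mk⇔
    (λ o → let h , o′ = to (Occ-∷⇔ α u n) o in cong₂ _∷_ h (to (Occ⇔window u (suc n)) o′))
    (λ e → let h , e′ = ∷-injective e in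
           from (Occ-∷⇔ α u n) (h , from (Occ⇔window u (suc n)) e′))

  Occ⇔window-of-occ : ∀ u {i₀} → Occ y u i₀ →
    ∀ n → Occ y u n ⇔ window y n (length u) ≡ window y i₀ (length u)
  Occ⇔window-of-occ u {i₀} occ-i₀ n = ⇔-trans (Occ⇔window u n) (≡⇔≡ refl (sym (to (Occ⇔window u i₀) occ-i₀)))

  Occ-tabulate⇔ : ∀ {l} (f : Fin l → A) n → Occ y (tabulate f) n ⇔ (∀ r → y (n + toℕ r) ≡ f r)
  Occ-tabulate⇔ {zero} f n = mk⇔ (λ _ ()) (λ _ ())
  Occ-tabulate⇔ {suc l} f n = mk⇔
    (λ o → let h , o′ = to (Occ-∷⇔ (f zero) (tabulate (f ∘ suc)) n) o in
      λ { zero → trans (cong y (+-identityʳ n)) h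
        ; (suc r) → trans (cong y (+-suc n (toℕ r))) (to (Occ-tabulate⇔ (f ∘ suc) (suc n)) o′ r) })
    (λ h → from (Occ-∷⇔ (f zero) (tabulate (f ∘ suc)) n)
      ( trans (cong y (sym (+-identityʳ n))) (h zero)
      , from (Occ-tabulate⇔ (f ∘ suc) (suc n))
             (λ r → trans (cong y (sym (+-suc n (toℕ r)))) (h (suc r)))))

  IsFactor-window⇔ : ∀ u N →
    IsFactor u (window y 0 N) ⇔ ∃ λ n → n + length u ≤ N × window y n (length u) ≡ u
  IsFactor-window⇔ u N = mk⇔ factor⇒ factor⇐
    where
    window-++₃ : ∀ i l l′ l″ →
      window y i (l + (l′ + l″)) ≡ window y i l ++ window y (i + l) l′ ++ window y (i + l + l′) l″
    window-++₃ i l l′ l″ =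
      trans (window-++ i l (l′ + l″)) (cong (window y i l ++_) (window-++ (i + l) l′ l″))

    factor⇒ : IsFactor u (window y 0 N) → ∃ λ n → n + length u ≤ N × window y n (length u) ≡ u
    factor⇒ (p , s , e) =
      length p , bound , sym (proj₁ (++-injective u (window y (length p) (length u)) (sym (length-window _ _)) e″))
      where
      N≡ : length p + (length u + length s) ≡ N
      N≡ = trans (sym (trans (length-++ p) (cong (length p +_) (length-++ u))))
                 (trans (cong length e) (length-window 0 N))
      bound : length p + length u ≤ N
      bound = subst (length p + length u ≤_) N≡ (+-monoʳ-≤ (length p) (m≤m+n (length u) (length s)))
      e′ : p ++ u ++ s ≡
           window y 0 (length p) ++ window y (length p) (length u) ++ window y (length p + length u) (length s)
      e′ = trans e (trans (cong (window y 0) (sym N≡)) (window-++₃ 0 (length p) (length u) (length s)))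
      e″ : u ++ s ≡ window y (length p) (length u) ++ window y (length p + length u) (length s)
      e″ = proj₂ (++-injective p (window y 0 (length p)) (sym (length-window 0 (length p))) e′)

    factor⇐ : (∃ λ n → n + length u ≤ N × window y n (length u) ≡ u) → IsFactor u (window y 0 N)
    factor⇐ (n , bound , e) = window y 0 n , window y (n + length u) rest , (begin
      window y 0 n ++ u ++ window y (n + length u) rest
        ≡⟨ cong (λ v → window y 0 n ++ v ++ window y (n + length u) rest) (sym e) ⟩
      window y 0 n ++ window y n (length u) ++ window y (n + length u) rest
        ≡⟨ sym (window-++₃ 0 n (length u) rest) ⟩
      window y 0 (n + (length u + rest))
        ≡⟨ cong (window y 0) (trans (sym (+-assoc n (length u) rest)) (m+[n∸m]≡n bound)) ⟩
      window y 0 N ∎)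
      where
      open ≡-Reasoning
      rest : ℕ
      rest = N ∸ (n + length u)

-- The Fibonacci word

X : ℕ → Bool
X n = x (suc n)

σIter-suc-suc : ∀ p → σIter (suc (suc p)) ≡ σIter (suc p) ++ σIter p
σIter-suc-suc zero = refl
σIter-suc-suc (suc p) =
  trans (cong (concatMap σ) (σIter-suc-suc p)) (concatMap-++ σ (σIter (suc p)) (σIter p))

length-σIter : ∀ p → length (σIter p) ≡ G p
length-σIter zero = refl
length-σIter (suc zero) = refl
length-σIter (suc (suc p)) = begin
  length (σIter (suc (suc p)))            ≡⟨ cong length (σIter-suc-suc p) ⟩
  length (σIter (suc p) ++ σIter p)       ≡⟨ length-++ (σIter (suc p)) ⟩
  length (σIter (suc p)) + length (σIter p) ≡⟨ cong₂ _+_ (length-σIter (suc p)) (length-σIter p) ⟩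
  G (suc (suc p))                         ∎
  where open ≡-Reasoning

σIter-prefix : ∀ p {n} → n < G p → nth false (σIter p) n ≡ nth false (σIter (suc p)) n
σIter-prefix zero {zero} _ = refl
σIter-prefix zero {suc n} (s≤s ())
σIter-prefix (suc p) {n} n< = sym (trans (cong (λ v → nth false v n) (σIter-suc-suc p))
  (nth-++ˡ false (σIter (suc p)) (σIter p) (subst (n <_) (sym (length-σIter (suc p))) n<)))

σIter-stable : ∀ {p p′ n} → p ≤ p′ → n < G p → nth false (σIter p) n ≡ nth false (σIter p′) n
σIter-stable {p} {n = n} p≤p′ n< = go (≤⇒≤′ p≤p′)
  where
  go : ∀ {p′} → p ≤′ p′ → nth false (σIter p) n ≡ nth false (σIter p′) n
  go ≤′-refl = refl
  go (≤′-step {n = p′} h) = trans (go h) (σIter-prefix p′ (<-≤-trans n< (G-mono-≤ (≤′⇒≤ h))))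

X-σIter : ∀ p {n} → n < G p → X n ≡ nth false (σIter p) n
X-σIter p {n} n< with ≤-total p (suc n)
... | inj₁ p≤ = sym (σIter-stable p≤ n<)
... | inj₂ ≤p = σIter-stable ≤p (<-≤-trans (n<G n) (G-mono-≤ (n≤1+n n)))

σIter≡window : ∀ p → σIter p ≡ window X 0 (G p)
σIter≡window p = trans
  (nth-agree⇒≡window X false (σIter p) 0 (λ r r< → sym (X-σIter p (subst (r <_) (length-σIter p) r<))))
  (cong (window X 0) (length-σIter p))

swap-suffix : ∀ t → ∃₂ λ g β → σIter (suc t) ++ σIter t ≡ g ++ β ∷ not β ∷ []
                               × σIter t ++ σIter (suc t) ≡ g ++ not β ∷ β ∷ []
swap-suffix zero = true ∷ [] , false , refl , refl
swap-suffix (suc t) with swap-suffix t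
... | g , β , e₁ , e₂ = σIter (suc t) ++ g , not β , e₁′ , e₂′
  where
  open ≡-Reasoning
  s : List Bool
  s = σIter (suc t)
  e₁′ : σIter (suc (suc t)) ++ s ≡ (s ++ g) ++ not β ∷ not (not β) ∷ []
  e₁′ = begin
    σIter (suc (suc t)) ++ s        ≡⟨ cong (_++ s) (σIter-suc-suc t) ⟩
    (s ++ σIter t) ++ s             ≡⟨ ++-assoc s (σIter t) s ⟩
    s ++ σIter t ++ s               ≡⟨ cong (s ++_) e₂ ⟩
    s ++ g ++ not β ∷ β ∷ []        ≡⟨ sym (++-assoc s g _) ⟩
    (s ++ g) ++ not β ∷ β ∷ []      ≡⟨ cong (λ γ → (s ++ g) ++ not β ∷ γ ∷ []) (sym (not-involutive β)) ⟩
    (s ++ g) ++ not β ∷ not (not β) ∷ [] ∎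
  e₂′ : s ++ σIter (suc (suc t)) ≡ (s ++ g) ++ not (not β) ∷ not β ∷ []
  e₂′ = begin
    s ++ σIter (suc (suc t))        ≡⟨ cong (s ++_) (σIter-suc-suc t) ⟩
    s ++ s ++ σIter t               ≡⟨ cong (s ++_) e₁ ⟩
    s ++ g ++ β ∷ not β ∷ []        ≡⟨ sym (++-assoc s g _) ⟩
    (s ++ g) ++ β ∷ not β ∷ []      ≡⟨ cong (λ γ → (s ++ g) ++ γ ∷ not β ∷ []) (sym (not-involutive β)) ⟩
    (s ++ g) ++ not (not β) ∷ not β ∷ [] ∎

module _ (s : ℕ) where
  private
    g : List Bool
    g = proj₁ (swap-suffix s)
    β : Bool
    β = proj₁ (proj₂ (swap-suffix s))
    fg : σIter (suc s) ++ σIter s ≡ g ++ β ∷ not β ∷ []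
    fg = proj₁ (proj₂ (proj₂ (swap-suffix s)))
    gf : σIter s ++ σIter (suc s) ≡ g ++ not β ∷ β ∷ []
    gf = proj₂ (proj₂ (proj₂ (swap-suffix s)))

    |g|+2 : length g + 2 ≡ G (suc (suc s))
    |g|+2 = begin
      length g + 2                      ≡⟨ sym (length-++ g) ⟩
      length (g ++ β ∷ not β ∷ [])      ≡⟨ cong length (sym fg) ⟩
      length (σIter (suc s) ++ σIter s) ≡⟨ sym (cong length (σIter-suc-suc s)) ⟩
      length (σIter (suc (suc s)))      ≡⟨ length-σIter (suc (suc s)) ⟩
      G (suc (suc s))                   ∎
      where open ≡-Reasoning

    X-low : ∀ {y} → y < G (suc (suc s)) → X y ≡ nth false (g ++ β ∷ not β ∷ []) y
    X-low {y} y< =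
      trans (X-σIter (suc (suc s)) y<) (cong (λ v → nth false v y) (trans (σIter-suc-suc s) fg))

    X-high : ∀ {y} → y < G (suc (suc s)) → X (G (suc s) + y) ≡ nth false (g ++ not β ∷ β ∷ []) y
    X-high {y} y< = begin
      X (G (suc s) + y)
        ≡⟨ X-σIter (suc (suc (suc s))) (subst (_< G (suc (suc (suc s)))) (+-comm y (G (suc s)))
                                                (+-monoˡ-< (G (suc s)) y<)) ⟩
      nth false (σIter (suc (suc (suc s)))) (G (suc s) + y)
        ≡⟨ cong (λ v → nth false v (G (suc s) + y)) three-blocks ⟩
      nth false (σIter (suc s) ++ σIter s ++ σIter (suc s)) (G (suc s) + y)
        ≡⟨ cong (λ k → nth false (σIter (suc s) ++ σIter s ++ σIter (suc s)) (k + y))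
                (sym (length-σIter (suc s))) ⟩
      nth false (σIter (suc s) ++ σIter s ++ σIter (suc s)) (length (σIter (suc s)) + y)
        ≡⟨ nth-++ʳ false (σIter (suc s)) _ y ⟩
      nth false (σIter s ++ σIter (suc s)) y
        ≡⟨ cong (λ v → nth false v y) gf ⟩
      nth false (g ++ not β ∷ β ∷ []) y ∎
      where
      open ≡-Reasoning
      three-blocks : σIter (suc (suc (suc s))) ≡ σIter (suc s) ++ σIter s ++ σIter (suc s)
      three-blocks = trans (σIter-suc-suc (suc s))
        (trans (cong (_++ σIter (suc s)) (σIter-suc-suc s))
               (++-assoc (σIter (suc s)) (σIter s) (σIter (suc s))))

  X-period-suc : ∀ y → 2 + y < G (suc (suc s)) → X (G (suc s) + y) ≡ X y
  X-period-suc y h = begin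
    X (G (suc s) + y)                 ≡⟨ X-high y< ⟩
    nth false (g ++ not β ∷ β ∷ []) y ≡⟨ nth-++ˡ false g _ y<g ⟩
    nth false g y                     ≡⟨ sym (nth-++ˡ false g _ y<g) ⟩
    nth false (g ++ β ∷ not β ∷ []) y ≡⟨ sym (X-low y<) ⟩
    X y                               ∎
    where
    open ≡-Reasoning
    y< : y < G (suc (suc s))
    y< = <-trans (m<n+m y (s≤s z≤n)) h
    y<g : y < length g
    y<g = +-cancelʳ-< 2 y (length g) (subst (y + 2 <_) (sym |g|+2) (subst (_< G (suc (suc s))) (+-comm 2 y) h))

  X-antiperiod-suc : ∀ y → 2 + y ≡ G (suc (suc s)) → X (G (suc s) + y) ≡ not (X y)
  X-antiperiod-suc y h = begin
    X (G (suc s) + y)                 ≡⟨ X-high y< ⟩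
    nth false (g ++ not β ∷ β ∷ []) y ≡⟨ at-|g| (not β) β ⟩
    not β                             ≡⟨ cong not (at-|g| β (not β)) ⟨
    not (nth false (g ++ β ∷ not β ∷ []) y) ≡⟨ cong not (X-low y<) ⟨
    not (X y)                         ∎
    where
    open ≡-Reasoning
    y< : y < G (suc (suc s))
    y< = subst (y <_) h (m<n+m y (s≤s z≤n))
    at-|g| : ∀ γ γ′ → nth false (g ++ γ ∷ γ′ ∷ []) y ≡ γ
    at-|g| γ γ′ = trans (cong (nth false (g ++ γ ∷ γ′ ∷ [])) y≡) (nth-++ʳ false g (γ ∷ γ′ ∷ []) 0)
      where
      y≡ : y ≡ length g + 0
      y≡ = trans (+-cancelʳ-≡ 2 y (length g) (trans (+-comm y 2) (trans h (sym |g|+2))))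
                 (sym (+-identityʳ (length g)))

X-period : ∀ t y → 2 + y < G (suc t) → X (G t + y) ≡ X y
X-period zero y (s≤s (s≤s ()))
X-period (suc t) = X-period-suc t

X-antiperiod : ∀ t y → 2 + y ≡ G (suc t) → X (G t + y) ≡ not (X y)
X-antiperiod zero zero refl = refl
X-antiperiod (suc t) = X-antiperiod-suc t

-- Zeckendorf sets

-- 𝒵_q described from its smallest part upwards: 𝒵_q = {0} ∪ 𝒵_{q+1} ∪ (𝒵_{q+2} ⊞ G q).
data Zeck (q : ℕ) : ℕ → Set where
  none : Zeck q 0
  skip : ∀ {n} → Zeck (suc q) n → Zeck q n
  use  : ∀ {n} → Zeck (2 + q) n → Zeck q (n + G q)

Zeck-lower : ∀ {q t n} → q ≤ t → Zeck t n → Zeck q n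
Zeck-lower q≤t = go (≤⇒≤′ q≤t)
  where
  go : ∀ {q t n} → q ≤′ t → Zeck t n → Zeck q n
  go ≤′-refl z = z
  go (≤′-step h) z = go h (skip z)

Zeck-shift : ∀ {q z} i → Zeck q z → 2 + i < G (suc q) → X (z + i) ≡ X i
Zeck-shift i none h = refl
Zeck-shift {q} i (skip z) h = Zeck-shift i z (<-trans h (G-<-suc (suc q)))
Zeck-shift {q} i (use {n} z) h = begin
  X (n + G q + i)   ≡⟨ cong X (+-assoc n (G q) i) ⟩
  X (n + (G q + i)) ≡⟨ Zeck-shift (G q + i) z (<-trans shifted-bound (G-<-suc (suc (suc q)))) ⟩
  X (G q + i)       ≡⟨ X-period q i h ⟩
  X i               ∎
  where
  open ≡-Reasoning
  shifted-bound : 2 + (G q + i) < G (suc (suc q))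
  shifted-bound = subst (_< G (suc (suc q))) (cong (2 +_) (+-comm i (G q))) (+-monoˡ-< (G q) h)

Zeck-flip : ∀ {q z} i → Zeck (2 + q) z → 2 + i ≡ G (suc q) → X (z + G q + i) ≡ not (X i)
Zeck-flip {q} {z} i zq h = begin
  X (z + G q + i)   ≡⟨ cong X (+-assoc z (G q) i) ⟩
  X (z + (G q + i)) ≡⟨ Zeck-shift (G q + i) zq end< ⟩
  X (G q + i)       ≡⟨ X-antiperiod q i h ⟩
  not (X i)         ∎
  where
  open ≡-Reasoning
  end< : 2 + (G q + i) < G (suc (suc (suc q)))
  end< = subst (_< G (suc (suc (suc q)))) (sym (trans (cong (2 +_) (+-comm (G q) i)) (cong (_+ G q) h)))
               (G-<-suc (suc (suc q)))

Zeck-shift-boundary : ∀ {q z} i → 2 + i ≡ G (suc q) → Zeck (suc q) z → X (z + i) ≡ X i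
Zeck-shift-boundary {q} i h z = Zeck-shift i z (subst (_< G (suc (suc q))) (sym h) (G-<-suc (suc q)))

Zeck-agree⇔ : ∀ {q z} i → 2 + i ≡ G (suc q) → (Zeck q z × X (z + i) ≡ X i) ⇔ Zeck (suc q) z
Zeck-agree⇔ i h = mk⇔
  (λ { (none , _) → none
     ; (skip z , _) → z
     ; (use z , e) → ⊥-elim (not-¬ refl (trans (sym e) (Zeck-flip i z h))) })
  (λ z → skip z , Zeck-shift-boundary i h z)

Zeck-disagree⇔ : ∀ {q z} i → 2 + i ≡ G (suc q) →
  (Zeck q z × X (z + i) ≡ not (X i)) ⇔ InShift (Zeck (2 + q)) (G q) z
Zeck-disagree⇔ i h = mk⇔
  (λ { (none , e) → ⊥-elim (not-¬ refl e)
     ; (skip z , e) → ⊥-elim (not-¬ refl (trans (sym (Zeck-shift-boundary i h z)) e))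
     ; (use {n} z , _) → n , z , refl })
  (λ { (n , z , refl) → use z , Zeck-flip i z h })

sumG-∷ʳ : ∀ r t → sum (map G (r ∷ʳ t)) ≡ sum (map G r) + G t
sumG-∷ʳ r t = trans (cong sum (map-++ G r (t ∷ [])))
  (trans (sum-++ (map G r) (G t ∷ [])) (cong (sum (map G r) +_) (+-identityʳ (G t))))

NonConsec-∷ : ∀ {t} r → NonConsec r → All (λ s → 2 + s ≤ t) r → NonConsec (t ∷ r)
NonConsec-∷ [] _ _ = _
NonConsec-∷ (s ∷ r) nc (h ∷ _) = h , nc

NonConsec-∷ʳ⁺ : ∀ {t} r → NonConsec r → All (2 + t ≤_) r → NonConsec (r ∷ʳ t)
NonConsec-∷ʳ⁺ [] _ _ = _
NonConsec-∷ʳ⁺ (s ∷ []) _ (h ∷ []) = h , _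
NonConsec-∷ʳ⁺ (s ∷ s′ ∷ r) (le , nc) (_ ∷ hs) = le , NonConsec-∷ʳ⁺ (s′ ∷ r) nc hs

NonConsec-∷ʳ⁻ : ∀ {t} r → NonConsec (r ∷ʳ t) → NonConsec r × All (2 + t ≤_) r
NonConsec-∷ʳ⁻ [] _ = _ , []
NonConsec-∷ʳ⁻ (s ∷ []) (h , _) = _ , h ∷ []
NonConsec-∷ʳ⁻ (s ∷ s′ ∷ r) (le , nc) with NonConsec-∷ʳ⁻ (s′ ∷ r) nc
... | nc′ , h ∷ hs = (le , nc′) , ≤-trans h (≤-trans (m≤n+m s′ 2) le) ∷ h ∷ hs

Zeck⇒Z : ∀ {q n} → Zeck q n → Z q n
Zeck⇒Z none = [] , (_ , refl) , []
Zeck⇒Z (skip z) with Zeck⇒Z z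
... | r , rep , above = r , rep , All.map <⇒≤ above
Zeck⇒Z {q} (use z) with Zeck⇒Z z
... | r , (nc , e) , above =
  r ∷ʳ q , (NonConsec-∷ʳ⁺ r nc above , trans (sumG-∷ʳ r q) (cong (_+ G q) e)) ,
  ∷ʳ⁺ (All.map (≤-trans (m≤n+m q 2)) above) ≤-refl

Z⇒Zeck : ∀ {q n} → Z q n → Zeck q n
Z⇒Zeck (r , (nc , refl) , above) = go (reverseView r) nc above
  where
  go : ∀ {q r} → Reverse r → NonConsec r → All (q ≤_) r → Zeck q (sum (map G r))
  go [] _ _ = none
  go (r ∶ rv ∶ʳ t) nc above with NonConsec-∷ʳ⁻ r nc | ∷ʳ⁻ above
  ... | nc′ , above′ | _ , q≤t =
    subst (Zeck _) (sym (sumG-∷ʳ r t)) (Zeck-lower q≤t (use (go rv nc′ above′)))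

Representation : ℕ → ℕ → Set
Representation p n = ∃ λ r → IsRep n r × All (_< p) r

greedy-step : ∀ p n → n < G (suc (suc p)) →
  (∀ n → n < G (suc p) → Representation (suc p) n) → (∀ n → n < G p → Representation p n) →
  Representation (suc (suc p)) n
greedy-step p n h below-suc below with n <? G (suc p)
... | yes n< with below-suc n n<
...   | r , rep , all< = r , rep , All.map m<n⇒m<1+n all<
greedy-step p n h below-suc below | no n≮ with below (n ∸ G (suc p)) rest<
  where
  rest< : n ∸ G (suc p) < G p
  rest< = +-cancelˡ-< (G (suc p)) _ _ (subst (_< G (suc p) + G p) (sym (m+[n∸m]≡n (≮⇒≥ n≮))) h)
...   | r , (nc , e) , all< =
  suc p ∷ r ,
  (NonConsec-∷ r nc (All.map s≤s all<) , trans (cong (G (suc p) +_) e) (m+[n∸m]≡n (≮⇒≥ n≮))) ,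
  n<1+n (suc p) ∷ All.map (m<n⇒m<1+n ∘ m<n⇒m<1+n) all<

zeckendorf : ∀ p n → n < G p → Representation p n
zeckendorf zero zero _ = [] , (_ , refl) , []
zeckendorf zero (suc n) (s≤s ())
zeckendorf (suc zero) zero _ = [] , (_ , refl) , []
zeckendorf (suc zero) (suc zero) _ = 0 ∷ [] , (_ , refl) , s≤s z≤n ∷ []
zeckendorf (suc zero) (suc (suc n)) (s≤s (s≤s ()))
zeckendorf (suc (suc p)) n h = greedy-step p n h (zeckendorf (suc p)) (zeckendorf p)

Zeck-0-total : ∀ n → Zeck 0 n
Zeck-0-total n with zeckendorf n n (n<G n)
... | r , rep , all< = Z⇒Zeck (r , rep , All.map (λ _ → z≤n) all<)

-- Occurrences of factors of the Fibonacci word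

InShift-cong : ∀ {S T : ℕ → Set} {t} → (∀ z → S z ⇔ T z) → ∀ n → InShift S t n ⇔ InShift T t n
InShift-cong S⇔T n = mk⇔ (λ { (z , sz , e) → z , to (S⇔T z) sz , e })
                         (λ { (z , tz , e) → z , from (S⇔T z) tz , e })

InShift-InShift : ∀ {S : ℕ → Set} t t′ n → InShift (InShift S t) t′ n ⇔ InShift S (t + t′) n
InShift-InShift t t′ n = mk⇔
  (λ { (z , (z′ , sz′ , refl) , refl) → z′ , sz′ , +-assoc z′ t t′ })
  (λ { (z′ , sz′ , refl) → z′ + t , (z′ , sz′ , refl) , sym (+-assoc z′ t t′) })

-- The occurrences of the length-l block at i₀ form 𝒵_level ⊞ first; end-below and end-above say
-- that the occurrence at first lies inside g_{level+1} but not inside g_level.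
record Occurrences (i₀ l : ℕ) : Set where
  field
    level first : ℕ
    occurs⇔     : ∀ n → window X n l ≡ window X i₀ l ⇔ InShift (Zeck level) first n
    first-bound : first + G level < G (suc level)
    end-above   : G level < 2 + (first + l)
    end-below   : 2 + (first + l) ≤ G (suc level)

occurrences-empty : ∀ i₀ → Occurrences i₀ 0
occurrences-empty i₀ = record
  { level = 0 ; first = 0
  ; occurs⇔ = λ n → mk⇔ (λ _ → n , Zeck-0-total n , sym (+-identityʳ n)) (λ _ → refl)
  ; first-bound = s≤s (s≤s z≤n) ; end-above = s≤s (s≤s z≤n) ; end-below = s≤s (s≤s z≤n) }

module Extend {i₀ l} (O : Occurrences i₀ l) where
  open Occurrences O

  i : ℕ
  i = first + l

  α : Bool
  α = X (i₀ + l)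

  occurs-suc⇔ : ∀ {P : ℕ → Set} → (∀ z → (Zeck level z × X (z + i) ≡ α) ⇔ P z) →
    ∀ n → window X n (suc l) ≡ window X i₀ (suc l) ⇔ InShift P first n
  occurs-suc⇔ P⇔ n = mk⇔
    (λ e → let e′ , αe = ∷ʳ-injective _ _ (trans (sym (window-∷ʳ X n l))
                                                   (trans e (window-∷ʳ X i₀ l)))
               z , zz , n≡ = to (occurs⇔ n) e′
           in z , to (P⇔ z) (zz , trans (cong X (sym (shift n≡))) αe) , n≡)
    (λ { (z , pz , n≡) → let zz , αe = from (P⇔ z) pz in
           trans (window-∷ʳ X n l)
             (trans (cong₂ _∷ʳ_ (from (occurs⇔ n) (z , zz , n≡)) (trans (cong X (shift n≡)) αe))
                    (sym (window-∷ʳ X i₀ l))) })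
    where
    shift : ∀ {z} → n ≡ z + first → n + l ≡ z + i
    shift {z} refl = +-assoc z first l

  inside : 2 + i < G (suc level) → Occurrences i₀ (suc l)
  inside h = record
    { level = level ; first = first
    ; occurs⇔ = occurs-suc⇔ (λ z → mk⇔ proj₁ (λ zz → zz , trans (Zeck-shift i zz h) (sym α≡Xi)))
    ; first-bound = first-bound
    ; end-above = <-≤-trans end-above (+-monoʳ-≤ 2 (+-monoʳ-≤ first (n≤1+n l)))
    ; end-below = subst (_≤ G (suc level)) (cong (2 +_) (sym (+-suc first l))) h }
    where
    α≡Xi : α ≡ X i
    α≡Xi with to (occurs⇔ i₀) refl
    ... | z₀ , zz₀ , i₀≡ =
      trans (cong X (trans (cong (_+ l) i₀≡) (+-assoc z₀ first l))) (Zeck-shift i zz₀ h)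

  boundary-agree : 2 + i ≡ G (suc level) → α ≡ X i → Occurrences i₀ (suc l)
  boundary-agree h α≡ = record
    { level = suc level ; first = first
    ; occurs⇔ = occurs-suc⇔ agree⇔
    ; first-bound = subst (first + G (suc level) <_) (+-comm (G level) (G (suc level)))
                          (+-monoˡ-< (G (suc level)) first<G)
    ; end-above = subst (G (suc level) <_) (sym end≡) ≤-refl
    ; end-below = subst (_≤ G (suc (suc level))) (sym end≡) (m<m+n (G (suc level)) (G-positive level)) }
    where
    agree⇔ : ∀ z → (Zeck level z × X (z + i) ≡ α) ⇔ Zeck (suc level) z
    agree⇔ z rewrite α≡ = Zeck-agree⇔ i h
    first<G : first < G level
    first<G = +-cancelʳ-< (G level) first (G level) (<-≤-trans first-bound (G-suc≤double level))
    end≡ : 2 + (first + suc l) ≡ suc (G (suc level))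
    end≡ = trans (cong (2 +_) (+-suc first l)) (cong suc h)

  boundary-disagree : 2 + i ≡ G (suc level) → α ≡ not (X i) → Occurrences i₀ (suc l)
  boundary-disagree h α≡ = record
    { level = suc (suc level) ; first = G level + first
    ; occurs⇔ = λ n → ⇔-trans (occurs-suc⇔ disagree⇔ n) (InShift-InShift (G level) first n)
    ; first-bound = first-bound′
    ; end-above = subst (G (suc (suc level)) <_) (sym end≡) ≤-refl
    ; end-below = subst (_≤ G (suc (suc (suc level)))) (sym end≡)
                        (m<m+n (G (suc (suc level))) (G-positive (suc level))) }
    where
    disagree⇔ : ∀ z → (Zeck level z × X (z + i) ≡ α) ⇔ InShift (Zeck (2 + level)) (G level) z
    disagree⇔ z rewrite α≡ = Zeck-disagree⇔ i h
    first-bound′ : G level + first + G (suc (suc level)) < G (suc (suc (suc level)))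
    first-bound′ = begin-strict
      G level + first + G (suc (suc level)) ≡⟨ cong (_+ G (suc (suc level))) (+-comm (G level) first) ⟩
      first + G level + G (suc (suc level)) <⟨ +-monoˡ-< (G (suc (suc level))) first-bound ⟩
      G (suc level) + G (suc (suc level))   ≡⟨ +-comm (G (suc level)) (G (suc (suc level))) ⟩
      G (suc (suc (suc level)))             ∎
      where open ≤-Reasoning
    end≡ : 2 + (G level + first + suc l) ≡ suc (G (suc (suc level)))
    end≡ = trans (reassociate (G level) first l) (cong (λ m → suc (m + G level)) h)
      where
      reassociate : ∀ g f l → 2 + (g + f + suc l) ≡ suc (2 + (f + l) + g)
      reassociate = solve-∀

extend : ∀ {i₀ l} → Occurrences i₀ l → Occurrences i₀ (suc l)
extend {i₀} {l} O with m≤n⇒m<n∨m≡n (Occurrences.end-below O)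
... | inj₁ inside = Extend.inside O inside
... | inj₂ boundary with X (i₀ + l) Bool.≟ X (Occurrences.first O + l)
...   | yes α≡ = Extend.boundary-agree O boundary α≡
...   | no α≢ = Extend.boundary-disagree O boundary (¬-not α≢)

occurrences : ∀ i₀ l → Occurrences i₀ l
occurrences i₀ zero = occurrences-empty i₀
occurrences i₀ (suc l) = extend (occurrences i₀ l)

IsLeast-unique : ∀ {P : ℕ → Set} {m n} → IsLeast P m → IsLeast P n → m ≡ n
IsLeast-unique (pm , m-least) (pn , n-least) = ≤-antisym (m-least _ pn) (n-least _ pm)

IsLeast-cong : ∀ {P Q : ℕ → Set} {m} → (∀ n → P n ⇔ Q n) → IsLeast P m → IsLeast Q m
IsLeast-cong P⇔Q (pm , m-least) = to (P⇔Q _) pm , λ n qn → m-least n (from (P⇔Q n) qn)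

InShift-Zeck-least : ∀ q t → IsLeast (InShift (Zeck q) t) t
InShift-Zeck-least q t = (0 , none , refl) , λ { _ (z , _ , refl) → m≤n+m t z }

fFin≡window : ∀ s₁ s₂ p → fFin s₁ s₂ p ≡ window (fInf s₁ s₂) 0 (G p)
fFin≡window s₁ s₂ p = trans (fFin≡map p)
  (trans (cong (map (sub s₁ s₂)) (σIter≡window p)) (map-window X (sub s₁ s₂) 0 (G p)))
  where
  fFin≡map : ∀ p → fFin s₁ s₂ p ≡ map (sub s₁ s₂) (σIter p)
  fFin≡map zero = refl
  fFin≡map (suc zero) = refl
  fFin≡map (suc (suc p)) = trans (cong₂ _++_ (fFin≡map (suc p)) (fFin≡map p))
    (trans (sym (map-++ (sub s₁ s₂) (σIter (suc p)) (σIter p)))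
           (cong (map (sub s₁ s₂)) (sym (σIter-suc-suc p))))

gFin≡window : ∀ s₁ s₂ p → gFin s₁ s₂ p ≡ window (fInf s₁ s₂) 0 (G p ∸ 2)
gFin≡window s₁ s₂ p rewrite fFin≡window s₁ s₂ p | length-window (fInf s₁ s₂) 0 (G p) =
  take-window (fInf s₁ s₂) 0 (m∸n≤m (G p) 2)

module _ {s₁ s₂ : Letter} (s₁≢s₂ : s₁ ≢ s₂) where

  sub-injective : ∀ {β γ} → sub s₁ s₂ β ≡ sub s₁ s₂ γ → β ≡ γ
  sub-injective {true} {true} _ = refl
  sub-injective {true} {false} e = ⊥-elim (s₁≢s₂ e)
  sub-injective {false} {true} e = ⊥-elim (s₁≢s₂ (sym e))
  sub-injective {false} {false} _ = refl

  window-fInf-≡⇔ : ∀ n i₀ l →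
    window (fInf s₁ s₂) n l ≡ window (fInf s₁ s₂) i₀ l ⇔ window X n l ≡ window X i₀ l
  window-fInf-≡⇔ n i₀ l = ⇔-trans
    (≡⇔≡ (sym (map-window X (sub s₁ s₂) n l)) (sym (map-window X (sub s₁ s₂) i₀ l)))
    (mk⇔ (map-injective sub-injective) (cong (map (sub s₁ s₂))))

  occurrences-fInf : ∀ {u fo m} → 0 < length u →
    IsLeast (Occ (fInf s₁ s₂) u) fo →
    IsLeast (λ m′ → (2 ≤ m′) × IsFactor u (gFin s₁ s₂ m′)) m →
    ∀ n → Occ (fInf s₁ s₂) u n ⇔ InShift (Z (m ∸ 1)) fo n
  occurrences-fInf {u} {fo} {m} 0<|u| fo-least m-least n =
    subst₂ (λ q t → Occ (fInf s₁ s₂) u n ⇔ InShift (Z q) t n) (cong (_∸ 1) (sym m≡)) (sym fo≡)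
      (⇔-trans (occ⇔ n) (InShift-cong (λ _ → mk⇔ Zeck⇒Z Z⇒Zeck) n))
    where
    open Occurrences (occurrences fo (length u))
    occ⇔ : ∀ n → Occ (fInf s₁ s₂) u n ⇔ InShift (Zeck level) first n
    occ⇔ n = ⇔-trans (Occ⇔window-of-occ (fInf s₁ s₂) u (proj₁ fo-least) n)
                     (⇔-trans (window-fInf-≡⇔ n fo (length u)) (occurs⇔ n))
    first-least : IsLeast (Occ (fInf s₁ s₂) u) first
    first-least = IsLeast-cong (λ n → ⇔-sym (occ⇔ n)) (InShift-Zeck-least level first)
    fo≡ : fo ≡ first
    fo≡ = IsLeast-unique fo-least first-least
    level-least : IsLeast (λ m′ → (2 ≤ m′) × IsFactor u (gFin s₁ s₂ m′)) (suc level)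
    level-least = (2≤ , factor) , least
      where
      2≤ : 2 ≤ suc level
      2≤ = G-cancel-< (<-≤-trans (+-monoʳ-< 2 (≤-trans 0<|u| (m≤n+m (length u) first))) end-below)
      factor : IsFactor u (gFin s₁ s₂ (suc level))
      factor = subst (IsFactor u) (sym (gFin≡window s₁ s₂ (suc level))) (from (IsFactor-window⇔ _ u _)
        ( first , m+n≤o⇒m≤o∸n (first + length u) (subst (_≤ G (suc level)) (+-comm 2 _) end-below)
        , to (Occ⇔window _ u first) (proj₁ first-least)))
      least : ∀ m′ → (2 ≤ m′) × IsFactor u (gFin s₁ s₂ m′) → suc level ≤ m′
      least m′ (2≤m′ , factor′)
        with to (IsFactor-window⇔ _ u _) (subst (IsFactor u) (gFin≡window s₁ s₂ m′) factor′)
      ... | n , n+|u|≤ , e = G-cancel-< (begin-strict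
        G level                  <⟨ end-above ⟩
        2 + (first + length u)   ≤⟨ +-monoʳ-≤ 2 (+-monoˡ-≤ (length u) first≤n) ⟩
        2 + (n + length u)       ≤⟨ +-monoʳ-≤ 2 n+|u|≤ ⟩
        2 + (G m′ ∸ 2)           ≡⟨ m+[n∸m]≡n (≤-trans (n≤1+n 2) (G-mono-≤ 2≤m′)) ⟩
        G m′                     ∎)
        where
        open ≤-Reasoning
        first≤n : first ≤ n
        first≤n = proj₂ first-least n (from (Occ⇔window _ u n) e)
    m≡ : m ≡ suc level
    m≡ = IsLeast-unique m-least level-least

-- The two-dimensional word

letter : Bool → Bool → Letter
letter true true = d
letter true false = c
letter false true = b
letter false false = a

rowBit colBit : Letter → Bool
rowBit d = true
rowBit c = true
rowBit b = false
rowBit a = false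
colBit d = true
colBit c = false
colBit b = true
colBit a = false

rowBit-letter : ∀ β γ → rowBit (letter β γ) ≡ β
rowBit-letter true true = refl
rowBit-letter true false = refl
rowBit-letter false true = refl
rowBit-letter false false = refl

colBit-letter : ∀ β γ → colBit (letter β γ) ≡ γ
colBit-letter true true = refl
colBit-letter true false = refl
colBit-letter false true = refl
colBit-letter false false = refl

letter-cancelʳ⇔ : ∀ {β β′ γ} → letter β γ ≡ letter β′ γ ⇔ β ≡ β′
letter-cancelʳ⇔ {β} {β′} {γ} = mk⇔
  (λ e → trans (sym (rowBit-letter β γ)) (trans (cong rowBit e) (rowBit-letter β′ γ)))
  (cong (λ β → letter β γ))

letter-cancelˡ⇔ : ∀ {β γ γ′} → letter β γ ≡ letter β γ′ ⇔ γ ≡ γ′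
letter-cancelˡ⇔ {β} {γ} {γ′} = mk⇔
  (λ e → trans (sym (colBit-letter β γ)) (trans (cong colBit e) (colBit-letter β γ′)))
  (cong (letter β))

f2≡letter : ∀ i j → f2 i j ≡ letter (x i) (x j)
f2≡letter i j with x i | x j
... | true | true = refl
... | true | false = refl
... | false | true = refl
... | false | false = refl

sub-colAlph : ∀ ℓ γ → sub (colAlph₁ ℓ) (colAlph₂ ℓ) γ ≡ letter γ (colBit ℓ)
sub-colAlph d true = refl
sub-colAlph d false = refl
sub-colAlph c true = refl
sub-colAlph c false = refl
sub-colAlph b true = refl
sub-colAlph b false = refl
sub-colAlph a true = refl
sub-colAlph a false = refl

sub-rowAlph : ∀ ℓ γ → sub (rowAlph₁ ℓ) (rowAlph₂ ℓ) γ ≡ letter (rowBit ℓ) γ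
sub-rowAlph d true = refl
sub-rowAlph d false = refl
sub-rowAlph c true = refl
sub-rowAlph c false = refl
sub-rowAlph b true = refl
sub-rowAlph b false = refl
sub-rowAlph a true = refl
sub-rowAlph a false = refl

colAlph-distinct : ∀ ℓ → colAlph₁ ℓ ≢ colAlph₂ ℓ
colAlph-distinct d ()
colAlph-distinct c ()
colAlph-distinct b ()
colAlph-distinct a ()

rowAlph-distinct : ∀ ℓ → rowAlph₁ ℓ ≢ rowAlph₂ ℓ
rowAlph-distinct d ()
rowAlph-distinct c ()
rowAlph-distinct b ()
rowAlph-distinct a ()

module _ {k l} (w : Fin (suc k) → Fin (suc l) → Letter) where

  colWord rowWord : ℕ → Letter
  colWord = fInf (colAlph₁ (w zero zero)) (colAlph₂ (w zero zero))
  rowWord = fInf (rowAlph₁ (w zero zero)) (rowAlph₂ (w zero zero))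

  factor-product : IsFactor2 w → ∀ r s → w r s ≡ letter (rowBit (w r zero)) (colBit (w zero s))
  factor-product (i₀ , j₀ , o) r s = trans (w≡ r s)
    (cong₂ letter (sym (trans (cong rowBit (w≡ r zero)) (rowBit-letter (X (i₀ + toℕ r)) (X (j₀ + 0)))))
                  (sym (trans (cong colBit (w≡ zero s)) (colBit-letter (X (i₀ + 0)) (X (j₀ + toℕ s))))))
    where
    w≡ : ∀ r s → w r s ≡ letter (X (i₀ + toℕ r)) (X (j₀ + toℕ s))
    w≡ r s = trans (sym (o r s)) (f2≡letter (suc (i₀ + toℕ r)) (suc (j₀ + toℕ s)))

  module _ (factor : IsFactor2 w) where

    Occ2⇔ : ∀ i j → Occ2 w i j ⇔
      ((∀ r → X (i + toℕ r) ≡ rowBit (w r zero)) × (∀ s → X (j + toℕ s) ≡ colBit (w zero s)))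
    Occ2⇔ i j = mk⇔
      (λ o → (λ r → trans (sym (rowBit-letter (X (i + toℕ r)) (X (j + 0))))
                          (cong rowBit (trans (sym (f2≡letter (suc (i + toℕ r)) (suc (j + 0)))) (o r zero))))
           , (λ s → trans (sym (colBit-letter (X (i + 0)) (X (j + toℕ s))))
                          (cong colBit (trans (sym (f2≡letter (suc (i + 0)) (suc (j + toℕ s)))) (o zero s)))))
      (λ { (row , col) r s → trans (f2≡letter (suc (i + toℕ r)) (suc (j + toℕ s)))
             (trans (cong₂ letter (row r) (col s)) (sym (factor-product factor r s))) })

    firstCol⇔ : ∀ i → Occ colWord (firstCol w) i ⇔ (∀ r → X (i + toℕ r) ≡ rowBit (w r zero))
    firstCol⇔ i = ⇔-trans (Occ-tabulate⇔ colWord (λ r → w r zero) i) (Π-cong⇔ λ r →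
      ⇔-trans (≡⇔≡ (sub-colAlph (w zero zero) (X (i + toℕ r))) (factor-product factor r zero)) letter-cancelʳ⇔)

    firstRow⇔ : ∀ j → Occ rowWord (firstRow w) j ⇔ (∀ s → X (j + toℕ s) ≡ colBit (w zero s))
    firstRow⇔ j = ⇔-trans (Occ-tabulate⇔ rowWord (λ s → w zero s) j) (Π-cong⇔ λ s →
      ⇔-trans (≡⇔≡ (sub-rowAlph (w zero zero) (X (j + toℕ s))) (factor-product factor zero s)) letter-cancelˡ⇔)

    Occ2⇔firstCol×firstRow : ∀ i j → Occ2 w i j ⇔ (Occ colWord (firstCol w) i × Occ rowWord (firstRow w) j)
    Occ2⇔firstCol×firstRow i j = ⇔-trans (Occ2⇔ i j) (⇔-sym (firstCol⇔ i ×-⇔ firstRow⇔ j))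

mainTheorem8 : (k l : ℕ) (w : Fin (suc k) → Fin (suc l) → Letter) →
    IsFactor2 w →
    (foL foT m n : ℕ) →
    IsLeast (Occ (fInf (colAlph₁ (w zero zero)) (colAlph₂ (w zero zero))) (firstCol w)) foL →
    IsLeast (Occ (fInf (rowAlph₁ (w zero zero)) (rowAlph₂ (w zero zero))) (firstRow w)) foT →
    IsLeast (λ m′ → (2 ≤ m′) × IsFactor (firstCol w) (gFin (colAlph₁ (w zero zero)) (colAlph₂ (w zero zero)) m′)) m →
    IsLeast (λ n′ → (2 ≤ n′) × IsFactor (firstRow w) (gFin (rowAlph₁ (w zero zero)) (rowAlph₂ (w zero zero)) n′)) n →
    (i j : ℕ) →
    Occ2 w i j ⇔ (InShift (Z (m ∸ 1)) foL i × InShift (Z (n ∸ 1)) foT j)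
mainTheorem8 k l w factor foL foT m n foL-least foT-least m-least n-least i j =
  ⇔-trans (Occ2⇔firstCol×firstRow w factor i j)
    (  occurrences-fInf (colAlph-distinct (w zero zero)) (s≤s z≤n) foL-least m-least i
    ×-⇔ occurrences-fInf (rowAlph-distinct (w zero zero)) (s≤s z≤n) foT-least n-least j)
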